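{- For every terminal $t\in T$, the number of cores $C$ with $t\in H(C)$ is at most $\frac{2(|T|-1)}{|T|-\ell}$.
   Context: Let $G=(V,E)$ be a finite undirected graph, $T\subseteq V$ a set of terminals and $\ell\ge 0$ an integer. Standing assumptions: $T$ is $\ell$-connected in $G$ (every pair of distinct terminals is joined by $\ell$ openly disjoint paths, i.e. paths sharing only their endpoints), $|T|\ge 2\ell$, and no two terminals are adjacent in $G$. For $U\subseteq V$, let $N(U)=\{v\in V\setminus U:\exists u\in U,\ uv\in E\}$ and $U^*=V\setminus(U\cup N(U))$. A deficient set is a set $U\subseteq V$ with $U\cap T\ne\emptyset$, $U^*\cap T\neq\emptyset$ and $|N(U)|<\ell+1$. A deficient set $U$ is small if $|U\cap T|\le |U^*\cap T|$. A core is an inclusionwise minimal small deficient set. For a core $C$, $\mathrm{Halo}(C)$ is the family of all small deficient sets $U$ with $C\subseteq U$ such that no core $D\ne C$ satisfies $D\subseteq U$, and the halo-set $H(C)$ is the union of all sets in $\mathrm{Halo}(C)$. -}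

module Defs where

open import Data.Nat using (ℕ; zero; suc; _<_; _≤_; _+_)
open import Data.Bool using (Bool; true; false; not; _∧_; _∨_)
open import Data.Fin using (Fin; zero; suc)
open import Data.Fin.Subset using (Subset; _∈_; _⊆_; ∁; _∩_; _∪_; ∣_∣; Nonempty)
open import Data.Vec using (tabulate; lookup)
open import Data.List using (List; []; _∷_; _++_)
open import Data.List.Relation.Unary.Linked using (Linked)
open import Data.List.Relation.Unary.Unique.Propositional using (Unique)
import Data.List.Membership.Propositional as LMem
open import Data.Product using (Σ; ∃; _×_)
open import Data.Empty using (⊥)
open import Relation.Binary.PropositionalEquality using (_≡_; _≢_)

record Graph (n : ℕ) : Set where
  field
    adj    : Fin n → Fin n → Bool
    sym    : ∀ u v → adj u v ≡ adj v u
    irrefl : ∀ v → adj v v ≡ false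
open Graph public

module _ {n : ℕ} (G : Graph n) where

  Edge : Fin n → Fin n → Set
  Edge u v = adj G u v ≡ true

  IsPath : Fin n → List (Fin n) → Fin n → Set
  IsPath s xs t = Linked Edge (s ∷ xs ++ t ∷ []) × Unique (s ∷ xs ++ t ∷ [])

  LConnected : Subset n → ℕ → Set
  LConnected T ℓ = ∀ s t → s ∈ T → t ∈ T → s ≢ t →
    Σ (Fin ℓ → List (Fin n)) λ P →
      (∀ i → IsPath s (P i) t) ×
      (∀ i j → i ≢ j → ∀ x → x LMem.∈ P i → x LMem.∈ P j → ⊥)

  NoAdjacentTerminals : Subset n → Set
  NoAdjacentTerminals T = ∀ s t → s ∈ T → t ∈ T → adj G s t ≡ false

anyFin : ∀ {m} → (Fin m → Bool) → Bool
anyFin {zero}  f = false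
anyFin {suc m} f = f zero ∨ anyFin (λ i → f (suc i))

module _ {n : ℕ} (G : Graph n) where

  Nbh : Subset n → Subset n
  Nbh U = tabulate λ v → not (lookup U v) ∧ anyFin (λ u → lookup U u ∧ adj G u v)

  Star : Subset n → Subset n
  Star U = ∁ (U ∪ Nbh U)

  module _ (T : Subset n) (ℓ : ℕ) where

    Deficient : Subset n → Set
    Deficient U = Nonempty (U ∩ T) × Nonempty (Star U ∩ T) × ∣ Nbh U ∣ < ℓ + 1

    SmallDeficient : Subset n → Set
    SmallDeficient U = Deficient U × ∣ U ∩ T ∣ ≤ ∣ Star U ∩ T ∣

    Core : Subset n → Set
    Core C = SmallDeficient C × (∀ U → SmallDeficient U → U ⊆ C → U ≡ C)

    InHalo : Subset n → Subset n → Set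
    InHalo C U = SmallDeficient U × C ⊆ U × (∀ D → Core D → D ⊆ U → D ≡ C)

    InHaloSet : Subset n → Fin n → Set
    InHaloSet C v = ∃ λ U → InHalo C U × v ∈ U

-- Fix, for every core C with t ∈ H(C), a halo set U ∋ t witnessing it. Because U is
-- small deficient, |T| ≤ |U ∩ T| + |U* ∩ T| + |N(U)| ≤ 2|U* ∩ T| + ℓ. The far sides
-- U* ∩ T of different cores are disjoint: a common terminal r would be separated from t
-- by U ∪ U′, so |N(U ∪ U′)| ≥ ℓ by ℓ-connectivity, and submodularity of |N| makes U ∩ U′
-- small deficient; a core inside U ∩ U′ lies in both halos, so the two cores coincide.
-- The far sides avoid t, hence their sizes add up to at most |T| − 1.
module Submission where

open import Data.Bool using (Bool; true; false; not; _∧_; _∨_)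
open import Data.Bool.Properties using (∨-zeroʳ; ¬-not)
open import Data.Empty using (⊥-elim)
open import Data.Fin using (Fin; zero; suc; _≟_)
open import Data.Fin.Properties using (suc-injective; 0≢1+n)
open import Data.Fin.Subset
  using (Subset; inside; outside; _∩_; _∪_; _⊂_; _∈_; _∉_; _⊆_; _-_; ⋃; ∣_∣; Empty)
open import Data.Fin.Subset.Properties
open import Data.Fin.Subset.Induction using (⊂-wellFounded; Acc; acc)
open import Data.List using (List; []; _∷_; _++_; map; length)
open import Data.List.Membership.Propositional using () renaming (_∈_ to _∈ₗ_)
open import Data.List.Relation.Unary.All as All using (All; []; _∷_)
open import Data.List.Relation.Unary.All.Properties using (All¬⇒¬Any)
open import Data.List.Relation.Unary.AllPairs using (AllPairs; []; _∷_)
open import Data.List.Relation.Unary.Any using (Any; here; there)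
open import Data.List.Relation.Unary.Linked using (Linked; _∷_)
open import Data.List.Relation.Unary.Unique.Propositional using (Unique)
open import Data.Nat using (ℕ; zero; suc; _+_; _*_; _∸_; _≤_; _<_; _≤?_; _<?_; z≤n; s≤s)
open import Data.Nat.ListAction using (sum)
open import Data.Nat.Properties
  using ( +-suc; +-comm; m≤n+m; ≤-trans; +-mono-≤; +-monoʳ-≤; +-cancelʳ-≤; *-distribˡ-+
        ; *-monoʳ-≤; suc[m]≤n⇒m≤pred[n]; m<1+n⇒m≤n; m≤n+o⇒m∸n≤o; module ≤-Reasoning)
open import Data.Nat.Tactic.RingSolver using (solve-∀)
open import Data.Product using (∃; _×_; _,_; proj₁; proj₂)
open import Data.Sum as Sum using (_⊎_; inj₁; inj₂)
open import Data.Vec using ([]; _∷_; lookup)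
open import Data.Vec.Properties using (lookup∘tabulate; []=⇒lookup; lookup⇒[]=)
open import Function using (_∘_)
open import Function.Definitions using (Injective)
open import Relation.Binary.PropositionalEquality
  using (_≡_; _≢_; refl; sym; trans; cong; cong₂; subst)
open import Relation.Nullary using (¬_; yes; no; contradiction)
open import Relation.Nullary.Decidable using (decidable-stable; _×-dec_)
open import Relation.Unary using (Decidable)

open import Defs hiding (sym)

∣p∩q∣+∣p∪q∣≡∣p∣+∣q∣ : ∀ {n} (p q : Subset n) → ∣ p ∩ q ∣ + ∣ p ∪ q ∣ ≡ ∣ p ∣ + ∣ q ∣
∣p∩q∣+∣p∪q∣≡∣p∣+∣q∣ [] [] = refl
∣p∩q∣+∣p∪q∣≡∣p∣+∣q∣ (inside ∷ p) (inside ∷ q) =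
  cong suc (trans (+-suc _ _) (trans (cong suc (∣p∩q∣+∣p∪q∣≡∣p∣+∣q∣ p q)) (sym (+-suc _ _))))
∣p∩q∣+∣p∪q∣≡∣p∣+∣q∣ (inside ∷ p) (outside ∷ q) =
  trans (+-suc _ _) (cong suc (∣p∩q∣+∣p∪q∣≡∣p∣+∣q∣ p q))
∣p∩q∣+∣p∪q∣≡∣p∣+∣q∣ (outside ∷ p) (inside ∷ q) =
  trans (+-suc _ _) (trans (cong suc (∣p∩q∣+∣p∪q∣≡∣p∣+∣q∣ p q)) (sym (+-suc _ _)))
∣p∩q∣+∣p∪q∣≡∣p∣+∣q∣ (outside ∷ p) (outside ∷ q) = ∣p∩q∣+∣p∪q∣≡∣p∣+∣q∣ p q

∣p∪q∣≤∣p∣+∣q∣ : ∀ {n} (p q : Subset n) → ∣ p ∪ q ∣ ≤ ∣ p ∣ + ∣ q ∣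
∣p∪q∣≤∣p∣+∣q∣ p q = subst (∣ p ∪ q ∣ ≤_) (∣p∩q∣+∣p∪q∣≡∣p∣+∣q∣ p q) (m≤n+m _ _)

∩-monoˡ-⊆ : ∀ {n} {p q : Subset n} r → p ⊆ q → p ∩ r ⊆ q ∩ r
∩-monoˡ-⊆ {p = p} r p⊆q x∈p∩r with x∈p∩q⁻ p r x∈p∩r
... | x∈p , x∈r = x∈p∩q⁺ (p⊆q x∈p , x∈r)

Disjoint : ∀ {n} → Subset n → Subset n → Set
Disjoint p q = Empty (p ∩ q)

disjoint⇒∣p∪q∣≡∣p∣+∣q∣ : ∀ {n} {p q : Subset n} → Disjoint p q → ∣ p ∪ q ∣ ≡ ∣ p ∣ + ∣ q ∣
disjoint⇒∣p∪q∣≡∣p∣+∣q∣ {n} {p} {q} p∩q=∅ =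
  trans (cong (_+ ∣ p ∪ q ∣) (sym (trans (cong ∣_∣ (Empty-unique p∩q=∅)) (∣⊥∣≡0 n))))
        (∣p∩q∣+∣p∪q∣≡∣p∣+∣q∣ p q)

x∈⋃⁻ : ∀ {n} {x : Fin n} (ps : List (Subset n)) → x ∈ ⋃ ps → Any (x ∈_) ps
x∈⋃⁻ []       x∈∅ = ⊥-elim (∉⊥ x∈∅)
x∈⋃⁻ (p ∷ ps) x∈⋃ with x∈p∪q⁻ p (⋃ ps) x∈⋃
... | inj₁ x∈p = here x∈p
... | inj₂ x∈⋃ps = there (x∈⋃⁻ ps x∈⋃ps)

⋃⊆ : ∀ {n} {q : Subset n} {ps : List (Subset n)} → All (_⊆ q) ps → ⋃ ps ⊆ q
⋃⊆ [] x∈∅ = ⊥-elim (∉⊥ x∈∅)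
⋃⊆ {ps = p ∷ ps} (p⊆q ∷ ps⊆q) x∈⋃ with x∈p∪q⁻ p (⋃ ps) x∈⋃
... | inj₁ x∈p = p⊆q x∈p
... | inj₂ x∈⋃ps = ⋃⊆ ps⊆q x∈⋃ps

∣⋃∣≡sum : ∀ {n} {ps : List (Subset n)} → AllPairs Disjoint ps → ∣ ⋃ ps ∣ ≡ sum (map ∣_∣ ps)
∣⋃∣≡sum {n} [] = ∣⊥∣≡0 n
∣⋃∣≡sum {ps = p ∷ ps} (p#ps ∷ disjoint) =
  trans (disjoint⇒∣p∪q∣≡∣p∣+∣q∣ p#⋃ps) (cong (∣ p ∣ +_) (∣⋃∣≡sum disjoint))
  where
  p#⋃ps : Disjoint p (⋃ ps)
  p#⋃ps (x , x∈p∩⋃) with x∈p∩q⁻ p (⋃ ps) x∈p∩⋃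
  ... | x∈p , x∈⋃ps =
    All¬⇒¬Any (All.map (λ p#q x∈q → p#q (x , x∈p∩q⁺ (x∈p , x∈q))) p#ps) (x∈⋃⁻ ps x∈⋃ps)

injection⇒m≤∣p∣ : ∀ {m n} {p : Subset n} (f : Fin m → Fin n) →
  Injective _≡_ _≡_ f → (∀ i → f i ∈ p) → m ≤ ∣ p ∣
injection⇒m≤∣p∣ {zero}  f _ _ = z≤n
injection⇒m≤∣p∣ {suc m} f f-inj f∈p =
  ≤-trans (s≤s (injection⇒m≤∣p∣ (f ∘ suc) (suc-injective ∘ f-inj) f∘suc∈p-f0))
          (x∈p⇒∣p-x∣<∣p∣ (f∈p zero))
  where
  f∘suc∈p-f0 : ∀ i → f (suc i) ∈ _ - f zero
  f∘suc∈p-f0 i = x∈p∧x≢y⇒x∈p-y (f∈p (suc i)) (λ eq → 0≢1+n (sym (f-inj eq)))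

anyFin⁺ : ∀ {m} (f : Fin m → Bool) i → f i ≡ true → anyFin f ≡ true
anyFin⁺ f zero    fi = cong (_∨ anyFin (f ∘ suc)) fi
anyFin⁺ f (suc i) fi = trans (cong (f zero ∨_) (anyFin⁺ (f ∘ suc) i fi)) (∨-zeroʳ (f zero))

anyFin⁻ : ∀ {m} (f : Fin m → Bool) → anyFin f ≡ true → ∃ λ i → f i ≡ true
anyFin⁻ {suc m} f any with f zero in f0
... | true  = zero , f0
... | false with anyFin⁻ (f ∘ suc) any
...   | i , fi = suc i , fi

∧≡true⁻ : ∀ {a b} → a ∧ b ≡ true → a ≡ true × b ≡ true
∧≡true⁻ {true} {true} _ = refl , refl

module _ {n} (G : Graph n) where

  HasNeighbourIn : Subset n → Fin n → Set
  HasNeighbourIn U v = ∃ λ u → u ∈ U × Edge G u v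

  HasNeighbourIn-mono : ∀ {U W v} → U ⊆ W → HasNeighbourIn U v → HasNeighbourIn W v
  HasNeighbourIn-mono U⊆W (u , u∈U , uv) = u , U⊆W u∈U , uv

  HasNeighbourIn-∪⁻ : ∀ {U W v} → HasNeighbourIn (U ∪ W) v → HasNeighbourIn U v ⊎ HasNeighbourIn W v
  HasNeighbourIn-∪⁻ {U} {W} (u , u∈U∪W , uv) =
    Sum.map (λ u∈U → u , u∈U , uv) (λ u∈W → u , u∈W , uv) (x∈p∪q⁻ U W u∈U∪W)

  private
    lookup-Nbh : ∀ U v →
      lookup (Nbh G U) v ≡ not (lookup U v) ∧ anyFin (λ u → lookup U u ∧ adj G u v)
    lookup-Nbh U v = lookup∘tabulate _ v

  ∈Nbh⁺ : ∀ {U v} → v ∉ U → HasNeighbourIn U v → v ∈ Nbh G U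
  ∈Nbh⁺ {U} {v} v∉U (u , u∈U , uv) = lookup⇒[]= v (Nbh G U) (trans (lookup-Nbh U v)
    (cong₂ (λ a b → not a ∧ b) (¬-not (v∉U ∘ lookup⇒[]= v U))
                               (anyFin⁺ _ u (cong₂ _∧_ ([]=⇒lookup u∈U) uv))))

  ∈Nbh⁻ : ∀ {U v} → v ∈ Nbh G U → v ∉ U × HasNeighbourIn U v
  ∈Nbh⁻ {U} {v} v∈N with lookup U v in v∈?U | trans (sym (lookup-Nbh U v)) ([]=⇒lookup v∈N)
  ... | false | touches with anyFin⁻ _ touches
  ...   | u , uv with ∧≡true⁻ uv
  ...     | u∈U , edge =
    (λ v∈U → contradiction (trans (sym ([]=⇒lookup v∈U)) v∈?U) λ ()) , u , lookup⇒[]= u U u∈U , edge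

  ∈Star⁺ : ∀ {U v} → v ∉ U → ¬ HasNeighbourIn U v → v ∈ Star G U
  ∈Star⁺ {U} v∉U ¬touches = x∉p⇒x∈∁p λ v∈U∪N →
    Sum.[ v∉U , ¬touches ∘ proj₂ ∘ ∈Nbh⁻ ]′ (x∈p∪q⁻ U (Nbh G U) v∈U∪N)

  ∈Star⁻ : ∀ {U v} → v ∈ Star G U → v ∉ U × ¬ HasNeighbourIn U v
  ∈Star⁻ {U} {v} v∈S = v∉U , λ touches → x∈∁p⇒x∉p v∈S (x∈p∪q⁺ (inj₂ (∈Nbh⁺ v∉U touches)))
    where
    v∉U : v ∉ U
    v∉U v∈U = x∈∁p⇒x∉p v∈S (x∈p∪q⁺ (inj₁ v∈U))

  Star-antitone : ∀ {U W} → U ⊆ W → Star G W ⊆ Star G U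
  Star-antitone U⊆W v∈SW with ∈Star⁻ v∈SW
  ... | v∉W , ¬touches = ∈Star⁺ (v∉W ∘ U⊆W) (¬touches ∘ HasNeighbourIn-mono U⊆W)

  Star-∪⁺ : ∀ {U W v} → v ∈ Star G U → v ∈ Star G W → v ∈ Star G (U ∪ W)
  Star-∪⁺ {U} {W} v∈SU v∈SW with ∈Star⁻ v∈SU | ∈Star⁻ v∈SW
  ... | v∉U , ¬tU | v∉W , ¬tW =
    ∈Star⁺ (Sum.[ v∉U , v∉W ]′ ∘ x∈p∪q⁻ U W) (Sum.[ ¬tU , ¬tW ]′ ∘ HasNeighbourIn-∪⁻)

  Nbh-∩∩Nbh-∪⊆ : ∀ U W → Nbh G (U ∩ W) ∩ Nbh G (U ∪ W) ⊆ Nbh G U ∩ Nbh G W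
  Nbh-∩∩Nbh-∪⊆ U W v∈ with x∈p∩q⁻ (Nbh G (U ∩ W)) _ v∈
  ... | v∈N∩ , v∈N∪ with proj₂ (∈Nbh⁻ v∈N∩) | proj₁ (∈Nbh⁻ v∈N∪)
  ...   | t | v∉U∪W = x∈p∩q⁺ ( ∈Nbh⁺ (v∉U∪W ∘ p⊆p∪q W) (HasNeighbourIn-mono (p∩q⊆p U W) t)
                            , ∈Nbh⁺ (v∉U∪W ∘ q⊆p∪q U W) (HasNeighbourIn-mono (p∩q⊆q U W) t))

  Nbh-∩∪Nbh-∪⊆ : ∀ U W → Nbh G (U ∩ W) ∪ Nbh G (U ∪ W) ⊆ Nbh G U ∪ Nbh G W
  Nbh-∩∪Nbh-∪⊆ U W {v} v∈ with x∈p∪q⁻ (Nbh G (U ∩ W)) _ v∈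
  ... | inj₂ v∈N∪ with ∈Nbh⁻ v∈N∪
  ...   | v∉U∪W , t = x∈p∪q⁺
    (Sum.map (∈Nbh⁺ (v∉U∪W ∘ p⊆p∪q W)) (∈Nbh⁺ (v∉U∪W ∘ q⊆p∪q U W)) (HasNeighbourIn-∪⁻ t))
  Nbh-∩∪Nbh-∪⊆ U W {v} v∈ | inj₁ v∈N∩ with ∈Nbh⁻ v∈N∩ | v ∈? U
  ... | v∉U∩W , t | yes v∈U =
    x∈p∪q⁺ (inj₂ (∈Nbh⁺ (λ v∈W → v∉U∩W (x∈p∩q⁺ (v∈U , v∈W))) (HasNeighbourIn-mono (p∩q⊆q U W) t)))
  ... | _     , t | no v∉U  = x∈p∪q⁺ (inj₁ (∈Nbh⁺ v∉U (HasNeighbourIn-mono (p∩q⊆p U W) t)))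

  Nbh-submodular : ∀ U W → ∣ Nbh G (U ∩ W) ∣ + ∣ Nbh G (U ∪ W) ∣ ≤ ∣ Nbh G U ∣ + ∣ Nbh G W ∣
  Nbh-submodular U W = begin
    ∣ N∩ ∣ + ∣ N∪ ∣                  ≡⟨ ∣p∩q∣+∣p∪q∣≡∣p∣+∣q∣ N∩ N∪ ⟨
    ∣ N∩ ∩ N∪ ∣ + ∣ N∩ ∪ N∪ ∣        ≤⟨ +-mono-≤ (p⊆q⇒∣p∣≤∣q∣ (Nbh-∩∩Nbh-∪⊆ U W))
                                                  (p⊆q⇒∣p∣≤∣q∣ (Nbh-∩∪Nbh-∪⊆ U W)) ⟩
    ∣ Nbh G U ∩ Nbh G W ∣ + ∣ Nbh G U ∪ Nbh G W ∣ ≡⟨ ∣p∩q∣+∣p∪q∣≡∣p∣+∣q∣ (Nbh G U) (Nbh G W) ⟩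
    ∣ Nbh G U ∣ + ∣ Nbh G W ∣         ∎
    where
    open ≤-Reasoning
    N∩ N∪ : Subset n
    N∩ = Nbh G (U ∩ W)
    N∪ = Nbh G (U ∪ W)

  ∣T∣≤∣U∩T∣+∣Star∩T∣+∣Nbh∣ : ∀ T U → ∣ T ∣ ≤ ∣ U ∩ T ∣ + (∣ Star G U ∩ T ∣ + ∣ Nbh G U ∣)
  ∣T∣≤∣U∩T∣+∣Star∩T∣+∣Nbh∣ T U = begin
    ∣ T ∣                                             ≤⟨ p⊆q⇒∣p∣≤∣q∣ T⊆ ⟩
    ∣ (U ∩ T) ∪ (Star G U ∩ T) ∪ Nbh G U ∣            ≤⟨ ∣p∪q∣≤∣p∣+∣q∣ (U ∩ T) _ ⟩
    ∣ U ∩ T ∣ + ∣ (Star G U ∩ T) ∪ Nbh G U ∣          ≤⟨ +-monoʳ-≤ ∣ U ∩ T ∣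
                                                           (∣p∪q∣≤∣p∣+∣q∣ (Star G U ∩ T) _) ⟩
    ∣ U ∩ T ∣ + (∣ Star G U ∩ T ∣ + ∣ Nbh G U ∣)      ∎
    where
    open ≤-Reasoning
    T⊆ : T ⊆ (U ∩ T) ∪ (Star G U ∩ T) ∪ Nbh G U
    T⊆ {v} v∈T with v ∈? U | v ∈? Nbh G U
    ... | yes v∈U | _       = x∈p∪q⁺ (inj₁ (x∈p∩q⁺ (v∈U , v∈T)))
    ... | no v∉U  | yes v∈N = x∈p∪q⁺ (inj₂ (x∈p∪q⁺ (inj₂ v∈N)))
    ... | no v∉U  | no v∉N  =
      x∈p∪q⁺ (inj₂ (x∈p∪q⁺ (inj₁ (x∈p∩q⁺ (∈Star⁺ v∉U (v∉N ∘ ∈Nbh⁺ v∉U) , v∈T)))))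

  path-crosses-Nbh : ∀ {U x r} ys → x ∈ U → r ∈ Star G U →
    Linked (Edge G) (x ∷ ys ++ r ∷ []) → ∃ λ b → b ∈ₗ ys × b ∈ Nbh G U
  path-crosses-Nbh []       x∈U r∈S (xr ∷ _) = contradiction (_ , x∈U , xr) (proj₂ (∈Star⁻ r∈S))
  path-crosses-Nbh {U} (y ∷ ys) x∈U r∈S (xy ∷ path) with y ∈? U
  ... | no y∉U  = y , here refl , ∈Nbh⁺ y∉U (_ , x∈U , xy)
  ... | yes y∈U with path-crosses-Nbh ys y∈U r∈S path
  ...   | b , b∈ys , b∈N = b , there b∈ys , b∈N

  LConnected⇒ℓ≤∣Nbh∣ : ∀ {T ℓ U s r} → LConnected G T ℓ →
    s ∈ T → s ∈ U → r ∈ T → r ∈ Star G U → ℓ ≤ ∣ Nbh G U ∣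
  LConnected⇒ℓ≤∣Nbh∣ {ℓ = ℓ} {U} {s} {r} conn s∈T s∈U r∈T r∈S
    with conn s r s∈T r∈T (λ { refl → proj₁ (∈Star⁻ r∈S) s∈U })
  ... | paths , isPath , disjoint = injection⇒m≤∣p∣ exit exit-injective (proj₂ ∘ proj₂ ∘ crossing)
    where
    crossing : ∀ i → ∃ λ b → b ∈ₗ paths i × b ∈ Nbh G U
    crossing i = path-crosses-Nbh (paths i) s∈U r∈S (proj₁ (isPath i))
    exit : Fin ℓ → Fin n
    exit = proj₁ ∘ crossing
    exit-injective : Injective _≡_ _≡_ exit
    exit-injective {i} {j} same = decidable-stable (i ≟ j) λ i≢j →
      disjoint i j i≢j (exit i) (proj₁ (proj₂ (crossing i)))
        (subst (_∈ₗ paths j) (sym same) (proj₁ (proj₂ (crossing j))))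

  module _ (T : Subset n) (ℓ : ℕ) where

    smallDeficient? : Decidable (SmallDeficient G T ℓ)
    smallDeficient? U =
      (nonempty? (U ∩ T) ×-dec nonempty? (Star G U ∩ T) ×-dec ∣ Nbh G U ∣ <? ℓ + 1)
      ×-dec ∣ U ∩ T ∣ ≤? ∣ Star G U ∩ T ∣

    SmallDeficient⇒∃Core⊆ : ∀ W → SmallDeficient G T ℓ W → ∃ λ C → Core G T ℓ C × C ⊆ W
    SmallDeficient⇒∃Core⊆ W = descend W (⊂-wellFounded W)
      where
      descend : ∀ W → Acc _⊂_ W → SmallDeficient G T ℓ W → ∃ λ C → Core G T ℓ C × C ⊆ W
      descend W (acc below) sdW with anySubset? (λ U → smallDeficient? U ×-dec U ⊂? W)
      ... | yes (U , sdU , U⊂W) with descend U (below U⊂W) sdU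
      ...   | C , core , C⊆U = C , core , ⊆-trans C⊆U (p⊂q⇒p⊆q U⊂W)
      descend W _ sdW | no ¬smaller = W , (sdW , minimal) , ⊆-refl
        where
        minimal : ∀ U → SmallDeficient G T ℓ U → U ⊆ W → U ≡ W
        minimal U sdU U⊆W = ⊆-antisym U⊆W λ {x} x∈W →
          decidable-stable (x ∈? U) λ x∉U → ¬smaller (U , sdU , U⊆W , x , x∈W , x∉U)

    Deficient⇒∣Nbh∣≤ℓ : ∀ {U} → Deficient G T ℓ U → ∣ Nbh G U ∣ ≤ ℓ
    Deficient⇒∣Nbh∣≤ℓ {U} (_ , _ , N<ℓ+1) = m<1+n⇒m≤n (subst (∣ Nbh G U ∣ <_) (+-comm ℓ 1) N<ℓ+1)

    SmallDeficient⇒∣T∣∸ℓ≤2∣Star∩T∣ : ∀ {U} →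
      SmallDeficient G T ℓ U → ∣ T ∣ ∸ ℓ ≤ 2 * ∣ Star G U ∩ T ∣
    SmallDeficient⇒∣T∣∸ℓ≤2∣Star∩T∣ {U} (deficient , small) = m≤n+o⇒m∸n≤o ∣ T ∣ ℓ (begin
      ∣ T ∣                           ≤⟨ ∣T∣≤∣U∩T∣+∣Star∩T∣+∣Nbh∣ T U ⟩
      ∣ U ∩ T ∣ + (S + ∣ Nbh G U ∣)   ≤⟨ +-mono-≤ small (+-monoʳ-≤ S (Deficient⇒∣Nbh∣≤ℓ deficient)) ⟩
      S + (S + ℓ)                     ≡⟨ rearrange S ℓ ⟩
      ℓ + 2 * S                       ∎)
      where
      open ≤-Reasoning
      S : ℕ
      S = ∣ Star G U ∩ T ∣
      rearrange : ∀ s l → s + (s + l) ≡ l + 2 * s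
      rearrange = solve-∀

    ∩-SmallDeficient : LConnected G T ℓ → ∀ {X Y t r} →
      SmallDeficient G T ℓ X → Deficient G T ℓ Y →
      t ∈ T → t ∈ X → t ∈ Y → r ∈ T → r ∈ Star G X → r ∈ Star G Y →
      SmallDeficient G T ℓ (X ∩ Y)
    ∩-SmallDeficient conn {X} {Y} (defX , smallX) defY t∈T t∈X t∈Y r∈T r∈SX r∈SY =
      ( (_ , x∈p∩q⁺ (x∈p∩q⁺ (t∈X , t∈Y) , t∈T))
      , (_ , x∈p∩q⁺ (Star-antitone (p∩q⊆p X Y) r∈SX , r∈T))
      , subst (∣ Nbh G (X ∩ Y) ∣ <_) (+-comm 1 ℓ) (s≤s ∣Nbh∩∣≤ℓ) )
      , small∩
      where
      open ≤-Reasoning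
      ℓ≤∣Nbh∪∣ : ℓ ≤ ∣ Nbh G (X ∪ Y) ∣
      ℓ≤∣Nbh∪∣ = LConnected⇒ℓ≤∣Nbh∣ conn t∈T (p⊆p∪q Y t∈X) r∈T (Star-∪⁺ r∈SX r∈SY)
      ∣Nbh∩∣≤ℓ : ∣ Nbh G (X ∩ Y) ∣ ≤ ℓ
      ∣Nbh∩∣≤ℓ = +-cancelʳ-≤ ℓ _ _ (begin
        ∣ Nbh G (X ∩ Y) ∣ + ℓ                   ≤⟨ +-monoʳ-≤ _ ℓ≤∣Nbh∪∣ ⟩
        ∣ Nbh G (X ∩ Y) ∣ + ∣ Nbh G (X ∪ Y) ∣   ≤⟨ Nbh-submodular X Y ⟩
        ∣ Nbh G X ∣ + ∣ Nbh G Y ∣               ≤⟨ +-mono-≤ (Deficient⇒∣Nbh∣≤ℓ defX)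
                                                            (Deficient⇒∣Nbh∣≤ℓ defY) ⟩
        ℓ + ℓ                                   ∎)
      small∩ : ∣ (X ∩ Y) ∩ T ∣ ≤ ∣ Star G (X ∩ Y) ∩ T ∣
      small∩ = begin
        ∣ (X ∩ Y) ∩ T ∣        ≤⟨ p⊆q⇒∣p∣≤∣q∣ (∩-monoˡ-⊆ T (p∩q⊆p X Y)) ⟩
        ∣ X ∩ T ∣              ≤⟨ smallX ⟩
        ∣ Star G X ∩ T ∣       ≤⟨ p⊆q⇒∣p∣≤∣q∣ (∩-monoˡ-⊆ T (Star-antitone (p∩q⊆p X Y))) ⟩
        ∣ Star G (X ∩ Y) ∩ T ∣ ∎

    InHalo-far-sides-disjoint : LConnected G T ℓ → ∀ {C₁ C₂ X Y t} → C₁ ≢ C₂ →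
      InHalo G T ℓ C₁ X → InHalo G T ℓ C₂ Y → t ∈ T → t ∈ X → t ∈ Y →
      Disjoint (Star G X ∩ T) (Star G Y ∩ T)
    InHalo-far-sides-disjoint conn {X = X} {Y} C₁≢C₂ (sdX , _ , onlyC₁) (sdY , _ , onlyC₂)
                              t∈T t∈X t∈Y (r , r∈) with x∈p∩q⁻ (Star G X ∩ T) _ r∈
    ... | r∈SX∩T , r∈SY∩T with x∈p∩q⁻ (Star G X) T r∈SX∩T | x∈p∩q⁻ (Star G Y) T r∈SY∩T
    ... | r∈SX , r∈T | r∈SY , _
      with SmallDeficient⇒∃Core⊆ (X ∩ Y)
             (∩-SmallDeficient conn sdX (proj₁ sdY) t∈T t∈X t∈Y r∈T r∈SX r∈SY)
    ... | D , core , D⊆X∩Y =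
      C₁≢C₂ (trans (sym (onlyC₁ D core (⊆-trans D⊆X∩Y (p∩q⊆p X Y))))
                   (onlyC₂ D core (⊆-trans D⊆X∩Y (p∩q⊆q X Y))))

    module _ (t : Fin n) where

      HaloCore : Subset n → Set
      HaloCore C = Core G T ℓ C × InHaloSet G T ℓ C t

      farSide : ∀ {C} → HaloCore C → Subset n
      farSide (_ , U , _) = Star G U ∩ T

      farSides : ∀ {Cs} → All HaloCore Cs → List (Subset n)
      farSides = All.reduce farSide

      length*[∣T∣∸ℓ]≤2*sum∣farSides∣ : ∀ {Cs} (hs : All HaloCore Cs) →
        length Cs * (∣ T ∣ ∸ ℓ) ≤ 2 * sum (map ∣_∣ (farSides hs))
      length*[∣T∣∸ℓ]≤2*sum∣farSides∣ [] = z≤n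
      length*[∣T∣∸ℓ]≤2*sum∣farSides∣ (h@(_ , _ , (sd , _) , _) ∷ hs) = begin
        (∣ T ∣ ∸ ℓ) + _                                     ≤⟨ +-mono-≤
                                                                 (SmallDeficient⇒∣T∣∸ℓ≤2∣Star∩T∣ sd)
                                                                 (length*[∣T∣∸ℓ]≤2*sum∣farSides∣ hs) ⟩
        2 * ∣ farSide h ∣ + 2 * sum (map ∣_∣ (farSides hs)) ≡⟨ *-distribˡ-+ 2 ∣ farSide h ∣ _ ⟨
        2 * sum (map ∣_∣ (farSides (h ∷ hs)))               ∎
        where open ≤-Reasoning

      farSides⊆T-t : ∀ {Cs} (hs : All HaloCore Cs) → All (_⊆ T - t) (farSides hs)
      farSides⊆T-t [] = []
      farSides⊆T-t ((_ , U , _ , t∈U) ∷ hs) = farSide⊆T-t ∷ farSides⊆T-t hs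
        where
        farSide⊆T-t : Star G U ∩ T ⊆ T - t
        farSide⊆T-t v∈ with x∈p∩q⁻ (Star G U) T v∈
        ... | v∈S , v∈T = x∈p∧x≢y⇒x∈p-y v∈T λ { refl → proj₁ (∈Star⁻ v∈S) t∈U }

      farSides-disjoint : LConnected G T ℓ → t ∈ T → ∀ {Cs} → Unique Cs →
        (hs : All HaloCore Cs) → AllPairs Disjoint (farSides hs)
      farSides-disjoint conn t∈T [] [] = []
      farSides-disjoint conn t∈T {C ∷ _} (C≢Cs ∷ unique) ((_ , U , halo , t∈U) ∷ hs) =
        apart C≢Cs hs ∷ farSides-disjoint conn t∈T unique hs
        where
        apart : ∀ {Cs} → All (C ≢_) Cs → (hs : All HaloCore Cs) →
          All (Disjoint (Star G U ∩ T)) (farSides hs)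
        apart [] [] = []
        apart (C≢C′ ∷ C≢Cs) ((_ , _ , halo′ , t∈U′) ∷ hs) =
          InHalo-far-sides-disjoint conn C≢C′ halo halo′ t∈T t∈U t∈U′ ∷ apart C≢Cs hs

lemma9 : ∀ {n} (G : Graph n) (T : Subset n) (ℓ : ℕ) →
    LConnected G T ℓ → 2 * ℓ ≤ ∣ T ∣ → NoAdjacentTerminals G T →
    ∀ (t : Fin n) → t ∈ T →
    ∀ (Cs : List (Subset n)) → Unique Cs →
    All (λ C → Core G T ℓ C × InHaloSet G T ℓ C t) Cs →
    length Cs * (∣ T ∣ ∸ ℓ) ≤ 2 * (∣ T ∣ ∸ 1)
lemma9 {n} G T ℓ conn _ _ t t∈T Cs unique hs = begin
  length Cs * (∣ T ∣ ∸ ℓ)             ≤⟨ length*[∣T∣∸ℓ]≤2*sum∣farSides∣ G T ℓ t hs ⟩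
  2 * sum (map ∣_∣ Ss)                ≡⟨ cong (2 *_) (∣⋃∣≡sum disjoint) ⟨
  2 * ∣ ⋃ Ss ∣                        ≤⟨ *-monoʳ-≤ 2 (p⊆q⇒∣p∣≤∣q∣ (⋃⊆ (farSides⊆T-t G T ℓ t hs))) ⟩
  2 * ∣ T - t ∣                       ≤⟨ *-monoʳ-≤ 2 (suc[m]≤n⇒m≤pred[n] (x∈p⇒∣p-x∣<∣p∣ t∈T)) ⟩
  2 * (∣ T ∣ ∸ 1)                     ∎
  where
  open ≤-Reasoning
  Ss : List (Subset n)
  Ss = farSides G T ℓ t hs
  disjoint : AllPairs Disjoint Ss
  disjoint = farSides-disjoint G T ℓ t conn t∈T unique hs
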